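{- Let $\mathbb{K}=(G,M,I)$ be a formal context and $R\subseteq G$. For every $R$-mixed generator $S$ in $\mathbb{K}$ and every $T\subseteq S\cap R$, the set $S\setminus T$ is an $R$-mixed generator in $\mathbb{K}$. In particular, if $R=m^{(I)}$ for some $m\in M$, and $g\in G$ with $(g,m)\notin I$ and $\mathbb{L}=\mathrm{op}^{g,m}(\mathbb{K})$, then $S\setminus R$ is an $R$-mixed generator in both $\mathbb{K}$ and $\mathbb{L}$; moreover $S\setminus R$ is an extent of $\mathbb{K}$ and therefore the unique $R$-mixed generator $U$ in $\mathbb{K}$ with $U^{II}=S\setminus R$.
   Context: For $A\subseteq G$, $A^I=\{n\in M:(a,n)\in I\ \forall a\in A\}$ and dually for $B\subseteq M$; same notation for other incidences. Extent: $A^{II}=A$. $m^{(I)}:=G\setminus m^I$. $\mathrm{op}^{g,m}(\mathbb{K})=(G,M,J)$ with $J=I\cup\{(g,n):n\in M\setminus\{m\}\}\cup\{(h,m):h\in G\setminus\{g\}\}$. A set $S\subseteq G$ is an $R$-mixed generator in $(G,M,I)$ if for every $h\in G$: (i) $h\in S\cap R\Rightarrow(S\setminus\{h\})^{II}\neq S^{II}$; (ii) $h\notin S\cup R\Rightarrow(S\cup\{h\})^{II}\neq S^{II}$; in $(G,M,J)$ the same with $J$ and the same $R$. -}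

module Defs where

open import Data.Bool using (Bool; true; false; not; _∧_)
open import Data.Product using (_×_; _,_)
open import Data.Sum using (_⊎_)
open import Relation.Binary.PropositionalEquality using (_≡_; _≢_)
open import Relation.Nullary using (¬_)
open import Relation.Unary using (Pred; _∈_; _∉_; _⊆_; _≐_)
open import Level using (0ℓ)

Subset : Set → Set
Subset X = X → Bool

⟦_⟧ : {X : Set} → Subset X → Pred X 0ℓ
⟦ A ⟧ x = A x ≡ true

_−_ : {X : Set} → Subset X → Subset X → Subset X
(A − B) x = A x ∧ not (B x)

_minus_ : {X : Set} → Subset X → X → Pred X 0ℓ
(A minus h) x = (A x ≡ true) × (x ≢ h)

_plus_ : {X : Set} → Subset X → X → Pred X 0ℓ
(A plus h) x = (A x ≡ true) ⊎ (x ≡ h)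

_↑ : {G M : Set} → (G → M → Set) → Pred G 0ℓ → Pred M 0ℓ
(J ↑) A n = ∀ a → a ∈ A → J a n

_↓ : {G M : Set} → (G → M → Set) → Pred M 0ℓ → Pred G 0ℓ
(J ↓) B h = ∀ n → n ∈ B → J h n

closure : {G M : Set} → (G → M → Set) → Pred G 0ℓ → Pred G 0ℓ
closure J A = (J ↓) ((J ↑) A)

rel : {G M : Set} → (G → M → Bool) → G → M → Set
rel I h n = I h n ≡ true

-- m^(I) = G ∖ m^I
coExt : {G M : Set} → (G → M → Bool) → M → Subset G
coExt I m h = not (I h m)

opInc : {G M : Set} → (G → M → Bool) → G → M → G → M → Set
opInc I g m h n = (I h n ≡ true) ⊎ ((h ≡ g) × (n ≢ m)) ⊎ ((n ≡ m) × (h ≢ g))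

IsMixedGenerator : {G M : Set} → (G → M → Set) → Subset G → Subset G → Set
IsMixedGenerator J R S =
  ∀ h → (S h ≡ true → R h ≡ true → ¬ (closure J (S minus h) ≐ closure J ⟦ S ⟧))
      × (S h ≡ false → R h ≡ false → ¬ (closure J (S plus h) ≐ closure J ⟦ S ⟧))

IsExtent : {G M : Set} → (G → M → Set) → Subset G → Set
IsExtent J A = closure J ⟦ A ⟧ ≐ ⟦ A ⟧

-- Removing from S an element of R only shrinks its closure, so no element outside S ∪ R can
-- become redundant, while an element of S ∩ R that became redundant would already have been
-- redundant in S.  When R = m^(I), the complement of R is the extent m^I; hence the closure of
-- S ∖ R stays inside m^I and, by condition (ii), cannot leave S ∖ R.  The operation op only adds
-- incidences at g (where m fails) and at m, so it puts no new elements of m^I into closures.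
module Submission where

open import Defs
open import Data.Bool using (Bool; true; false; not)
open import Data.Bool.Properties using (not-injective; ⇔→≡)
open import Data.Product using (_×_; _,_; proj₁; proj₂)
open import Data.Sum using (inj₁; inj₂)
open import Function using (_∘_; mk⇔)
open import Level using (0ℓ)
open import Relation.Binary.PropositionalEquality using (_≡_; _≢_; refl; sym; trans; cong)
open import Relation.Nullary using (¬_; contradiction)
open import Relation.Unary using (Pred; _∈_; _⊆_; _≐_)

true≢false : true ≢ false
true≢false ()

∈-−⁺ : {X : Set} (A B : Subset X) {x : X} → x ∈ ⟦ A ⟧ → B x ≡ false → x ∈ ⟦ A − B ⟧
∈-−⁺ A B {x} Ax Bx rewrite Ax | Bx = refl

∈-−⁻ : {X : Set} (A B : Subset X) {x : X} → x ∈ ⟦ A − B ⟧ → x ∈ ⟦ A ⟧ × B x ≡ false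
∈-−⁻ A B {x} x∈ with A x | B x
... | true | false = refl , refl

−-⊆ : {X : Set} (A B : Subset X) → ⟦ A − B ⟧ ⊆ ⟦ A ⟧
−-⊆ A B = proj₁ ∘ ∈-−⁻ A B

−-antitoneʳ : {X : Set} (A : Subset X) {B C : Subset X} → ⟦ B ⟧ ⊆ ⟦ C ⟧ → ⟦ A − C ⟧ ⊆ ⟦ A − B ⟧
−-antitoneʳ A {B} {C} B⊆C {x} x∈ = ∈-−⁺ A B (proj₁ (∈-−⁻ A C x∈)) x∉B
  where
  x∉B : B x ≡ false
  x∉B with B x in Bx
  ... | true = contradiction (trans (sym (B⊆C Bx)) (proj₂ (∈-−⁻ A C x∈))) true≢false
  ... | false = refl

module _ {G M : Set} (J : G → M → Set) where

  closure-mono : {A B : Pred G 0ℓ} → A ⊆ B → closure J A ⊆ closure J B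
  closure-mono A⊆B x∈ n n∈ = x∈ n (λ a a∈A → n∈ a (A⊆B a∈A))

  ⊆-closure : {A : Pred G 0ℓ} → A ⊆ closure J A
  ⊆-closure x∈A n n∈ = n∈ _ x∈A

  closure-least : {A B : Pred G 0ℓ} → A ⊆ closure J B → closure J A ⊆ closure J B
  closure-least A⊆ x∈ n n∈ = x∈ n (λ a a∈A → A⊆ a∈A n n∈)

  closure-plus-≐⇒∈ : {A : Subset G} {h : G}
    → closure J (A plus h) ≐ closure J ⟦ A ⟧ → h ∈ closure J ⟦ A ⟧
  closure-plus-≐⇒∈ (⊆ , _) = ⊆ (⊆-closure (inj₂ refl))

  ∈⇒closure-plus-≐ : {A : Subset G} {h : G}
    → h ∈ closure J ⟦ A ⟧ → closure J (A plus h) ≐ closure J ⟦ A ⟧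
  ∈⇒closure-plus-≐ {A} {h} h∈ = closure-least plus⊆ , closure-mono inj₁
    where
    plus⊆ : A plus h ⊆ closure J ⟦ A ⟧
    plus⊆ (inj₁ x∈A) = ⊆-closure x∈A
    plus⊆ (inj₂ refl) = h∈

  closure-minus-≐⇒∈ : {A : Subset G} {h : G}
    → h ∈ ⟦ A ⟧ → closure J (A minus h) ≐ closure J ⟦ A ⟧ → h ∈ closure J (A minus h)
  closure-minus-≐⇒∈ h∈A (_ , ⊇) = ⊇ (⊆-closure h∈A)

  -- Condition (ii) says exactly that the closure of U adds no element outside R.
  mixedGenerator-closure∖R⊆ : {R U : Subset G} {h : G} → IsMixedGenerator J R U
    → h ∈ closure J ⟦ U ⟧ → R h ≡ false → h ∈ ⟦ U ⟧
  mixedGenerator-closure∖R⊆ {U = U} {h} gen h∈ Rh with U h in Uh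
  ... | true = refl
  ... | false = contradiction (∈⇒closure-plus-≐ h∈) (proj₂ (gen h) Uh Rh)

  mixedGenerator-minus-isExtent : {R S : Subset G} → IsMixedGenerator J R S
    → closure J (λ x → R x ≡ false) ⊆ (λ x → R x ≡ false) → IsExtent J (S − R)
  mixedGenerator-minus-isExtent {R} {S} gen coR-closed = closed , ⊆-closure
    where
    closed : closure J ⟦ S − R ⟧ ⊆ ⟦ S − R ⟧
    closed {x} x∈ =
      ∈-−⁺ S R (mixedGenerator-closure∖R⊆ gen (closure-mono (−-⊆ S R) x∈) Rx) Rx
      where
      Rx : R x ≡ false
      Rx = coR-closed (closure-mono (proj₂ ∘ ∈-−⁻ S R) x∈)

  mixedGenerator-unique : {R U A : Subset G} → IsMixedGenerator J R U
    → closure J ⟦ U ⟧ ≐ ⟦ A ⟧ → (∀ {x} → x ∈ ⟦ A ⟧ → R x ≡ false) → ∀ x → U x ≡ A x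
  mixedGenerator-unique gen (⊆ , ⊇) A∩R=∅ x =
    ⇔→≡ (mk⇔ (⊆ ∘ ⊆-closure) (λ x∈A → mixedGenerator-closure∖R⊆ gen (⊇ x∈A) (A∩R=∅ x∈A)))

-- The decidability of a Boolean incidence replaces a case split on x ≡ h, which G need not support.
∈⇒closure-minus-≐ : {G M : Set} (I : G → M → Bool) {A : Subset G} {h : G}
  → h ∈ closure (rel I) (A minus h) → closure (rel I) (A minus h) ≐ closure (rel I) ⟦ A ⟧
∈⇒closure-minus-≐ I {A} {h} h∈ = closure-mono (rel I) proj₁ , closure-least (rel I) A⊆
  where
  A⊆ : ⟦ A ⟧ ⊆ closure (rel I) (A minus h)
  A⊆ {x} x∈A n n∈ with I x n in Ixn
  ... | true = refl
  ... | false = contradiction (n∈ x (x∈A , x≢h)) (λ Ixn′ → true≢false (trans (sym Ixn′) Ixn))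
    where
    x≢h : x ≢ h
    x≢h refl = true≢false (trans (sym (h∈ n n∈)) Ixn)

mixedGenerator-shrink : {G M : Set} (I : G → M → Bool) {R S S′ : Subset G}
  → IsMixedGenerator (rel I) R S → ⟦ S′ ⟧ ⊆ ⟦ S ⟧ → ⟦ S − R ⟧ ⊆ ⟦ S′ ⟧
  → IsMixedGenerator (rel I) R S′
mixedGenerator-shrink I {R} {S} {S′} gen S′⊆S S∖R⊆S′ h = irredundant , unaddable
  where
  irredundant : S′ h ≡ true → R h ≡ true → ¬ closure (rel I) (S′ minus h) ≐ closure (rel I) ⟦ S′ ⟧
  irredundant S′h Rh ≐S′ = proj₁ (gen h) (S′⊆S S′h) Rh (∈⇒closure-minus-≐ I h∈)
    where
    h∈ : h ∈ closure (rel I) (S minus h)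
    h∈ = closure-mono (rel I) (λ (x∈ , x≢h) → S′⊆S x∈ , x≢h) (closure-minus-≐⇒∈ (rel I) S′h ≐S′)

  unaddable : S′ h ≡ false → R h ≡ false → ¬ closure (rel I) (S′ plus h) ≐ closure (rel I) ⟦ S′ ⟧
  unaddable S′h Rh ≐S′ = true≢false (trans (sym (S∖R⊆S′ (∈-−⁺ S R h∈S Rh))) S′h)
    where
    h∈S : h ∈ ⟦ S ⟧
    h∈S = mixedGenerator-closure∖R⊆ (rel I) gen
      (closure-mono (rel I) S′⊆S (closure-plus-≐⇒∈ (rel I) ≐S′)) Rh

-- An incidence of op^{g,m} that I lacks lies in row g, which misses m, or in column m.
opInc-closure⊆closure : {G M : Set} (I : G → M → Bool) {g : G} {m : M} {A : Pred G 0ℓ} {h : G}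
  → I g m ≡ false → rel I h m → h ∈ closure (opInc I g m) A → h ∈ closure (rel I) A
opInc-closure⊆closure I Igm Ihm h∈ n n∈ with h∈ n (λ a a∈A → inj₁ (n∈ a a∈A))
... | inj₁ Ihn = Ihn
... | inj₂ (inj₁ (refl , _)) = contradiction (trans (sym Ihm) Igm) true≢false
... | inj₂ (inj₂ (refl , _)) = Ihm

mixedGenerator-opInc : {G M : Set} (I : G → M → Bool) {g : G} {m : M} {R A : Subset G}
  → I g m ≡ false → (∀ {x} → R x ≡ false → rel I x m) → (∀ {x} → x ∈ ⟦ A ⟧ → R x ≡ false)
  → IsMixedGenerator (rel I) R A → IsMixedGenerator (opInc I g m) R A
mixedGenerator-opInc I {g} {m} {R} {A} Igm coR⊆m A∩R=∅ gen h =
  (λ Ah Rh _ → true≢false (trans (sym Rh) (A∩R=∅ Ah))) ,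
  (λ Ah Rh ≐A → true≢false (trans (sym (mixedGenerator-closure∖R⊆ (rel I) gen (h∈ ≐A Rh) Rh)) Ah))
  where
  h∈ : closure (opInc I g m) (A plus h) ≐ closure (opInc I g m) ⟦ A ⟧ → R h ≡ false
    → h ∈ closure (rel I) ⟦ A ⟧
  h∈ ≐A Rh = opInc-closure⊆closure I Igm (coR⊆m Rh) (closure-plus-≐⇒∈ (opInc I g m) ≐A)

coExt-false⇒rel : {G M : Set} (I : G → M → Bool) {R : Subset G} {m : M}
  → (∀ h → R h ≡ coExt I m h) → ∀ {x} → R x ≡ false → rel I x m
coExt-false⇒rel I R≡coExt {x} Rx = not-injective (trans (sym (R≡coExt x)) Rx)

coExt-complement-closed : {G M : Set} (I : G → M → Bool) {R : Subset G} {m : M}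
  → (∀ h → R h ≡ coExt I m h) → closure (rel I) (λ x → R x ≡ false) ⊆ (λ x → R x ≡ false)
coExt-complement-closed I {m = m} R≡coExt {x} x∈ =
  trans (R≡coExt x) (cong not (x∈ m (λ _ → coExt-false⇒rel I R≡coExt)))

proposition7 : {G M : Set} (I : G → M → Bool) (R S : Subset G)
    → IsMixedGenerator (rel I) R S
    → ((T : Subset G) → (∀ x → T x ≡ true → (S x ≡ true × R x ≡ true))
        → IsMixedGenerator (rel I) R (S − T))
      × ((m : M) → (∀ h → R h ≡ coExt I m h) → (g : G) → I g m ≡ false
        → IsMixedGenerator (rel I) R (S − R)
          × IsMixedGenerator (opInc I g m) R (S − R)
          × IsExtent (rel I) (S − R)
          × ((U : Subset G) → IsMixedGenerator (rel I) R U
              → closure (rel I) ⟦ U ⟧ ≐ ⟦ S − R ⟧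
              → ∀ x → U x ≡ (S − R) x))
proposition7 I R S gen =
  (λ T T⊆S∩R →
    mixedGenerator-shrink I gen (−-⊆ S T) (−-antitoneʳ S (λ {x} Tx → proj₂ (T⊆S∩R x Tx)))) ,
  λ m R≡coExt g Igm →
    genS∖R ,
    mixedGenerator-opInc I Igm (coExt-false⇒rel I R≡coExt) S∖R∩R=∅ genS∖R ,
    mixedGenerator-minus-isExtent (rel I) gen (coExt-complement-closed I R≡coExt) ,
    λ U genU ≐S∖R → mixedGenerator-unique (rel I) genU ≐S∖R S∖R∩R=∅
  where
  S∖R∩R=∅ : ∀ {x} → x ∈ ⟦ S − R ⟧ → R x ≡ false
  S∖R∩R=∅ = proj₂ ∘ ∈-−⁻ S R

  genS∖R : IsMixedGenerator (rel I) R (S − R)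
  genS∖R = mixedGenerator-shrink I gen (−-⊆ S R) (λ x∈ → x∈)
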